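{- Let $n \ge 4$ be an even integer. If $n$ is not the sum of two primes, then the Goldbach factorization graph $F_n$ contains an exceptional autonomous component.
   Context: For an even integer $n\ge 4$, the Goldbach factorization graph is the directed weighted graph $F_n=(V_n,A_n,w_n)$ with vertex set $V_n=[2,n-2]\cap\mathbb{P}$ ($\mathbb{P}$ the set of primes), arc set $A_n=\{(s,t)\in V_n^2 : s \mid (n-t)\}$ (loops $(v,v)$ allowed), and weights $w_n((s,t))=\max\{e\ge 1: s^e\mid (n-t)\}$. An autonomous component of $F_n$ is a minimal (with respect to inclusion) nonempty subgraph of $F_n$ induced by a vertex set $U\subseteq V_n$ such that $(s,t)\notin A_n$ for every $s\in V_n\setminus U$ and $t\in U$. A Goldbach autonomous component (GAC) is an autonomous component induced by vertices $v_1,v_2\in V_n$ with $v_1+v_2=n$ (a single vertex if $v_1=v_2$, two vertices otherwise). A trivial autonomous component (TAC) is an autonomous component induced by a single vertex that is not a GAC. An exceptional autonomous component (EAC) is an autonomous component that is neither a TAC nor a GAC. -}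

module Defs where

open import Data.Nat using (ℕ; _+_; _∸_; _≤_)
open import Data.Nat.Divisibility using (_∣_)
open import Data.Nat.Primality using (Prime)
open import Data.List using (List)
open import Data.List.Membership.Propositional using (_∈_)
open import Data.Product using (_×_; ∃; ∃-syntax)
open import Data.Sum using (_⊎_)
open import Relation.Nullary using (¬_)
open import Relation.Binary.PropositionalEquality using (_≡_)
open import Function.Bundles using (_⇔_)

Vertex : ℕ → ℕ → Set
Vertex n v = Prime v × 2 ≤ v × v ≤ n ∸ 2

Arc : ℕ → ℕ → ℕ → Set
Arc n s t = Vertex n s × Vertex n t × s ∣ (n ∸ t)

-- A (finite) vertex set U ⊆ V_n, represented as a list; the induced
-- subgraph is determined by U, so we identify it with U.
_⊆_ : List ℕ → List ℕ → Set
W ⊆ U = ∀ x → x ∈ W → x ∈ U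

NonEmpty : List ℕ → Set
NonEmpty U = ∃[ u ] u ∈ U

IsAutonomous : ℕ → List ℕ → Set
IsAutonomous n U =
  (∀ u → u ∈ U → Vertex n u) ×
  NonEmpty U ×
  (∀ s t → Vertex n s → ¬ (s ∈ U) → t ∈ U → ¬ Arc n s t)

IsAutonomousComponent : ℕ → List ℕ → Set
IsAutonomousComponent n U =
  IsAutonomous n U × (∀ W → IsAutonomous n W → W ⊆ U → U ⊆ W)

IsGAC : ℕ → List ℕ → Set
IsGAC n U = IsAutonomousComponent n U ×
  ∃[ v₁ ] ∃[ v₂ ] (Vertex n v₁ × Vertex n v₂ × v₁ + v₂ ≡ n ×
    (∀ x → (x ∈ U) ⇔ (x ≡ v₁ ⊎ x ≡ v₂)))

IsTAC : ℕ → List ℕ → Set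
IsTAC n U = IsAutonomousComponent n U ×
  (∃[ v ] (∀ x → (x ∈ U) ⇔ (x ≡ v))) × ¬ IsGAC n U

IsEAC : ℕ → List ℕ → Set
IsEAC n U = IsAutonomousComponent n U × ¬ IsTAC n U × ¬ IsGAC n U

-- Call a vertex entered if it has a predecessor other than itself. Every prime
-- divisor r of n − s is at most n − 2, hence a vertex with an arc (r, s); so if s is
-- not entered, n − s is a power of s, whence s ∣ n and the loop is the only arc out
-- of s. Therefore no arc enters the set of entered vertices from outside, i.e. it is
-- autonomous, and it contains an autonomous component by finiteness. For n ≥ 8 it is
-- nonempty, because n − 3 = 3^a and n − 2 = 2^b contradict each other modulo 8. Its
-- component is no TAC, since a singleton {v} with an outside predecessor is not
-- autonomous, and no GAC, since n is not a sum of two primes.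
module Submission where

open import Level using (_⊔_)
open import Data.Nat using (ℕ; zero; suc; _+_; _*_; _∸_; _^_; _≤_; _<_; _<?_; _≤?_; z≤n; s≤s; _≟_; NonZero; >-nonZero; nonTrivial⇒n>1)
open import Data.Nat.Properties using (≤-trans; m∸n≤m; ∸-monoʳ-≤; m≤o∸n⇒m+n≤o; m+n≤o⇒m≤o∸n; m∸n+n≡m; m≤m+n; +-comm; anyUpTo?; allUpTo?)
open import Data.Nat.Divisibility using (_∣_; divides; _∣?_; ∣⇒≤; ∣-refl; n∣m*n; m∣m*n; ∣m+n∣m⇒∣n; ∣m∸n∣n⇒∣m)
open import Data.Nat.Induction using (<-wellFounded)
open import Data.Nat.ListAction using (product)
open import Data.Nat.ListAction.Properties using (∈⇒∣product)
open import Data.Nat.Primality using (Prime; prime?; prime[2]; prime⇒irreducible; prime⇒nonTrivial; ¬prime[1])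
open import Data.Nat.Primality.Factorisation using (factorise; module PrimeFactorisation)
open import Data.Nat.Tactic.RingSolver using (solve-∀)
open import Data.List using (List; []; _∷_; [_]; map; _++_; filter; length; upTo)
open import Data.List.Membership.Propositional using (_∈_; _∉_; find; lose)
open import Data.List.Membership.Propositional.Properties using (∈-map⁺; ∈-map⁻; ∈-++⁺ˡ; ∈-++⁺ʳ; ∈-++⁻; ∈-filter⁺; ∈-filter⁻; ∈-upTo⁺)
open import Data.List.Properties using (filter-notAll)
open import Data.List.Relation.Binary.Subset.Propositional using () renaming (_⊆_ to _⊆ₗ_)
open import Data.List.Relation.Binary.Sublist.Propositional as Sublist using ([]; _∷_; _∷ʳ_) renaming (_⊆_ to _⊑_)
open import Data.List.Relation.Binary.Sublist.Propositional.Properties using (filter-⊆)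
open import Data.List.Relation.Unary.All as All using (All; []; _∷_; all?)
open import Data.List.Relation.Unary.All.Properties using (¬All⇒Any¬)
open import Data.List.Relation.Unary.Any using (here; any?)
open import Data.Product using (∃-syntax; _×_; _,_; proj₁; proj₂)
open import Data.Sum using (inj₁; inj₂)
open import Function using (_on_; _∘_)
open import Function.Bundles using (Equivalence)
open import Induction.WellFounded using (WfRec; module All)
open import Relation.Binary.Construct.On as On using ()
open import Relation.Binary.Definitions using (DecidableEquality)
open import Relation.Binary.PropositionalEquality using (_≡_; _≢_; refl; sym; trans; cong; subst)
open import Relation.Nullary using (¬_; Dec; yes; no; contradiction)
open import Relation.Nullary.Decidable using (_×-dec_; ¬?; map′; from-yes; decidable-stable)
open import Relation.Unary using (Decidable)

open import Defs

module MinimalSublist {a} {A : Set a} (_≟ₐ_ : DecidableEquality A) where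

  open import Data.List.Membership.DecPropositional _≟ₐ_ using (_∈?_)

  sublists : List A → List (List A)
  sublists []       = [ [] ]
  sublists (x ∷ xs) = map (x ∷_) (sublists xs) ++ sublists xs

  ∈-sublists⁺ : ∀ {S U} → S ⊑ U → S ∈ sublists U
  ∈-sublists⁺ []           = here refl
  ∈-sublists⁺ (_ ∷ʳ S⊑U)   = ∈-++⁺ʳ _ (∈-sublists⁺ S⊑U)
  ∈-sublists⁺ (refl ∷ S⊑U) = ∈-++⁺ˡ (∈-map⁺ _ (∈-sublists⁺ S⊑U))

  ∈-sublists⁻ : ∀ {S} U → S ∈ sublists U → S ⊑ U
  ∈-sublists⁻ []      (here refl) = []
  ∈-sublists⁻ (x ∷ U) S∈ with ∈-++⁻ (map (x ∷_) (sublists U)) S∈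
  ... | inj₂ S∈′ = x ∷ʳ ∈-sublists⁻ U S∈′
  ... | inj₁ S∈′ with ∈-map⁻ (x ∷_) S∈′
  ...   | S′ , S′∈ , refl = refl ∷ ∈-sublists⁻ U S′∈

  module _ {p} {P : List A → Set p} (P? : Decidable P)
           (P-resp : ∀ {W W′} → W ⊆ₗ W′ → W′ ⊆ₗ W → P W → P W′) where

    IsMinimal : List A → Set (a ⊔ p)
    IsMinimal W = ∀ W′ → P W′ → W′ ⊆ₗ W → W ⊆ₗ W′

    -- If no sublist of U satisfying P is shorter than U, then U is minimal:
    -- a smaller W′ would yield the shorter sublist filter (_∈ W′) U.
    ∃minimal⊆ : ∀ U → P U → ∃[ W ] (W ⊆ₗ U × P W × IsMinimal W)
    ∃minimal⊆ = All.wfRec (On.wellFounded length <-wellFounded) _ Goal step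
      where
      Goal : List A → Set (a ⊔ p)
      Goal U = P U → ∃[ W ] (W ⊆ₗ U × P W × IsMinimal W)

      step : ∀ U → WfRec (_<_ on length) Goal U → Goal U
      step U rec pU with any? (λ S → P? S ×-dec length S <? length U) (sublists U)
      ... | yes ∃shorter with find ∃shorter
      ...   | S , S∈ , pS , S<U with rec S<U pS
      ...     | W , W⊆S , pW , minW =
        W , (λ x∈W → Sublist.lookup (∈-sublists⁻ U S∈) (W⊆S x∈W)) , pW , minW
      step U rec pU | no ∄shorter = U , (λ x∈U → x∈U) , pU , isMinimal
        where
        isMinimal : IsMinimal U
        isMinimal W′ pW′ W′⊆U with all? (_∈? W′) U
        ... | yes U⊆W′ = All.lookup U⊆W′
        ... | no U⊈W′ = contradiction (lose (∈-sublists⁺ (filter-⊆ (_∈? W′) U)) (pS , shorter)) ∄shorter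
          where
          S = filter (_∈? W′) U
          pS : P S
          pS = P-resp (λ x∈W′ → ∈-filter⁺ (_∈? W′) (W′⊆U x∈W′) x∈W′)
                      (λ x∈S → proj₂ (∈-filter⁻ (_∈? W′) {xs = U} x∈S)) pW′
          shorter : length S < length U
          shorter = filter-notAll (_∈? W′) U (¬All⇒Any¬ (_∈? W′) U U⊈W′)

prime[3] : Prime 3
prime[3] = from-yes (prime? 3)

prime⇒≥2 : ∀ {p} → Prime p → 2 ≤ p
prime⇒≥2 {p} pp = nonTrivial⇒n>1 p {{prime⇒nonTrivial pp}}

prime∣prime⇒≡ : ∀ {p q} → Prime p → Prime q → p ∣ q → p ≡ q
prime∣prime⇒≡ pp pq p∣q with prime⇒irreducible pq p∣q
... | inj₁ refl = contradiction pp ¬prime[1]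
... | inj₂ p≡q  = p≡q

product≡^length : ∀ {p xs} → All (_≡ p) xs → product xs ≡ p ^ length xs
product≡^length []          = refl
product≡^length {p} (refl ∷ xs) = cong (p *_) (product≡^length xs)

onlyPrimeDivisor⇒power : ∀ {m p} .{{_ : NonZero m}} →
                         (∀ r → Prime r → r ∣ m → r ≡ p) → ∃[ k ] m ≡ p ^ k
onlyPrimeDivisor⇒power {m} only =
  length factors , trans isFactorisation (product≡^length allEqual)
  where
  open PrimeFactorisation (factorise m)
  allEqual : All (_≡ _) factors
  allEqual = All.tabulate λ r∈ →
    only _ (All.lookup factorsPrime r∈) (subst (_ ∣_) (sym isFactorisation) (∈⇒∣product r∈))

-- 3 ^ (a + 2) + 1 = 8 · 3 ^ a + (3 ^ a + 1), so 3 ^ a + 1 ≡ 2 or 4 (mod 8).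
8∤3^a+1 : ∀ a → ¬ 8 ∣ 3 ^ a + 1
8∤3^a+1 zero          (divides (suc _) ())
8∤3^a+1 (suc zero)    (divides (suc _) ())
8∤3^a+1 (suc (suc a)) 8∣ =
  8∤3^a+1 a (∣m+n∣m⇒∣n (subst (8 ∣_) (expand (3 ^ a)) 8∣) (n∣m*n (3 ^ a)))
  where
  expand : ∀ x → 3 * (3 * x) + 1 ≡ x * 8 + (x + 1)
  expand = solve-∀

8∣2^b : ∀ b → 6 ≤ 2 ^ b → 8 ∣ 2 ^ b
8∣2^b 0 (s≤s ())
8∣2^b 1 (s≤s (s≤s ()))
8∣2^b 2 (s≤s (s≤s (s≤s (s≤s ()))))
8∣2^b (suc (suc (suc b))) _ = divides (2 ^ b) (expand (2 ^ b))
  where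
  expand : ∀ x → 2 * (2 * (2 * x)) ≡ x * 8
  expand = solve-∀

3^a+1≢2^b : ∀ a b → 6 ≤ 2 ^ b → 3 ^ a + 1 ≢ 2 ^ b
3^a+1≢2^b a b 6≤2^b eq = 8∤3^a+1 a (subst (8 ∣_) (sym eq) (8∣2^b b 6≤2^b))

open MinimalSublist _≟_ using (∃minimal⊆)

vertex? : ∀ n v → Dec (Vertex n v)
vertex? n v = prime? v ×-dec (2 ≤? v ×-dec v ≤? n ∸ 2)

arc? : ∀ n s t → Dec (Arc n s t)
arc? n s t = vertex? n s ×-dec (vertex? n t ×-dec s ∣? n ∸ t)

HasOtherPredecessor : ℕ → ℕ → Set
HasOtherPredecessor n t = ∃[ s ] (s ≢ t × Arc n s t)

module _ {n : ℕ} where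

  open import Data.List.Membership.DecPropositional _≟_ using (_∈?_)

  vertex⇒≤ : ∀ {v} → Vertex n v → v ≤ n
  vertex⇒≤ (_ , _ , v≤n∸2) = ≤-trans v≤n∸2 (m∸n≤m n 2)

  vertex⇒2≤n∸v : ∀ {v} → Vertex n v → 2 ≤ n ∸ v
  vertex⇒2≤n∸v {v} (_ , 2≤v , v≤n∸2) =
    m+n≤o⇒m≤o∸n 2 (subst (_≤ n) (+-comm v 2) (m≤o∸n⇒m+n≤o v 2≤n v≤n∸2))
    where
    2≤n = ≤-trans 2≤v (≤-trans v≤n∸2 (m∸n≤m n 2))

  vertex⇒nonZero[n∸v] : ∀ {v} → Vertex n v → NonZero (n ∸ v)
  vertex⇒nonZero[n∸v] vv = >-nonZero (≤-trans (s≤s z≤n) (vertex⇒2≤n∸v vv))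

  prime∣n∸v⇒arc : ∀ {r v} → Vertex n v → Prime r → r ∣ n ∸ v → Arc n r v
  prime∣n∸v⇒arc {r} {v} vv pr r∣n∸v = (pr , prime⇒≥2 pr , r≤n∸2) , vv , r∣n∸v
    where
    r≤n∸2 : r ≤ n ∸ 2
    r≤n∸2 = ≤-trans (∣⇒≤ {{vertex⇒nonZero[n∸v] vv}} r∣n∸v) (∸-monoʳ-≤ n (proj₁ (proj₂ vv)))

  divisor⇒arc-loop : ∀ {s t} → s ∣ n → Arc n s t → s ≡ t
  divisor⇒arc-loop {s} {t} s∣n ((ps , _) , vt@(pt , _) , s∣n∸t) =
    prime∣prime⇒≡ ps pt (∣m+n∣m⇒∣n (subst (s ∣_) (sym (m∸n+n≡m (vertex⇒≤ vt))) s∣n) s∣n∸t)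

  hasOtherPredecessor⇒vertex : ∀ {t} → HasOtherPredecessor n t → Vertex n t
  hasOtherPredecessor⇒vertex (_ , _ , _ , vt , _) = vt

  hasOtherPredecessor? : ∀ t → Dec (HasOtherPredecessor n t)
  hasOtherPredecessor? t = map′ (λ (s , _ , pred) → s , pred)
                                (λ (s , pred) → s , s≤s (vertex⇒≤ (proj₁ (proj₂ pred))) , pred)
                                (anyUpTo? (λ s → ¬? (s ≟ t) ×-dec arc? n s t) (suc n))

  ¬HasOtherPredecessor⇒power : ∀ {v} → Vertex n v → ¬ HasOtherPredecessor n v → ∃[ k ] n ∸ v ≡ v ^ k
  ¬HasOtherPredecessor⇒power {v} vv noPred = onlyPrimeDivisor⇒power {{vertex⇒nonZero[n∸v] vv}} only
    where
    only : ∀ r → Prime r → r ∣ n ∸ v → r ≡ v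
    only r pr r∣n∸v = decidable-stable (r ≟ v) λ r≢v → noPred (r , r≢v , prime∣n∸v⇒arc vv pr r∣n∸v)

  ¬HasOtherPredecessor⇒∣ : ∀ {v} → Vertex n v → ¬ HasOtherPredecessor n v → v ∣ n
  ¬HasOtherPredecessor⇒∣ {v} vv noPred with ¬HasOtherPredecessor⇒power vv noPred
  ... | zero  , n∸v≡1 = contradiction (subst (2 ≤_) n∸v≡1 (vertex⇒2≤n∸v vv)) λ { (s≤s ()) }
  ... | suc k , n∸v≡v^[1+k] =
    ∣m∸n∣n⇒∣m v (vertex⇒≤ vv) (subst (v ∣_) (sym n∸v≡v^[1+k]) (m∣m*n (v ^ k))) ∣-refl

  isAutonomous? : Decidable (IsAutonomous n)
  isAutonomous? U = allVertices? ×-dec (nonEmpty? U ×-dec closed?)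
    where
    allVertices? : Dec (∀ u → u ∈ U → Vertex n u)
    allVertices? = map′ (λ all _ → All.lookup all) (λ f → All.tabulate (f _)) (all? (vertex? n) U)
    nonEmpty? : ∀ W → Dec (NonEmpty W)
    nonEmpty? []      = no λ ()
    nonEmpty? (x ∷ _) = yes (x , here refl)
    Closed : Set
    Closed = ∀ s t → Vertex n s → s ∉ U → t ∈ U → ¬ Arc n s t
    ClosedAt : ℕ → Set
    ClosedAt s = All (λ t → ¬ (s ∉ U × Arc n s t)) U
    fromBounded : (∀ {s} → s < suc n → ClosedAt s) → Closed
    fromBounded h s t vs s∉ t∈ arc = All.lookup (h (s≤s (vertex⇒≤ vs))) t∈ (s∉ , arc)
    toBounded : Closed → ∀ {s} → s < suc n → ClosedAt s
    toBounded closed _ = All.tabulate λ t∈ (s∉ , arc) → closed _ _ (proj₁ arc) s∉ t∈ arc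
    closed? : Dec Closed
    closed? = map′ fromBounded toBounded
                   (allUpTo? (λ s → all? (λ t → ¬? (¬? (s ∈? U) ×-dec arc? n s t)) U) (suc n))

  isAutonomous-resp : ∀ {W W′} → W ⊆ₗ W′ → W′ ⊆ₗ W → IsAutonomous n W → IsAutonomous n W′
  isAutonomous-resp W⊆W′ W′⊆W (vertices , (x , x∈W) , closed) =
    (λ u u∈W′ → vertices u (W′⊆W u∈W′)) , (x , W⊆W′ x∈W) ,
    (λ s t vs s∉W′ t∈W′ → closed s t vs (λ s∈W → s∉W′ (W⊆W′ s∈W)) (W′⊆W t∈W′))

  ∃autonomousComponent⊆ : ∀ {U} → IsAutonomous n U → ∃[ W ] (W ⊆ U × IsAutonomousComponent n W)
  ∃autonomousComponent⊆ {U} autU with ∃minimal⊆ isAutonomous? isAutonomous-resp U autU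
  ... | W , W⊆U , autW , minW =
    W , (λ _ → W⊆U) , autW , λ W′ autW′ W′⊆W _ → minW W′ autW′ (W′⊆W _)

  withOtherPredecessor : List ℕ
  withOtherPredecessor = filter hasOtherPredecessor? (upTo (suc n))

  ∈-withOtherPredecessor⁺ : ∀ {v} → HasOtherPredecessor n v → v ∈ withOtherPredecessor
  ∈-withOtherPredecessor⁺ pred =
    ∈-filter⁺ hasOtherPredecessor? (∈-upTo⁺ (s≤s (vertex⇒≤ (hasOtherPredecessor⇒vertex pred)))) pred

  ∈-withOtherPredecessor⁻ : ∀ {v} → v ∈ withOtherPredecessor → HasOtherPredecessor n v
  ∈-withOtherPredecessor⁻ v∈ = proj₂ (∈-filter⁻ hasOtherPredecessor? {xs = upTo (suc n)} v∈)

  -- A vertex s outside has n ∸ s a power of s, so s ∣ n and its only arc is a loop.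
  withOtherPredecessor-autonomous : ∀ {v} → HasOtherPredecessor n v → IsAutonomous n withOtherPredecessor
  withOtherPredecessor-autonomous pred =
    (λ _ u∈ → hasOtherPredecessor⇒vertex (∈-withOtherPredecessor⁻ u∈)) ,
    (_ , ∈-withOtherPredecessor⁺ pred) ,
    λ s t vs s∉ t∈ arc →
      s∉ (subst (_∈ withOtherPredecessor)
                (sym (divisor⇒arc-loop (¬HasOtherPredecessor⇒∣ vs (s∉ ∘ ∈-withOtherPredecessor⁺)) arc))
                t∈)

  otherPredecessors⇒¬TAC : ∀ {W} → (∀ v → v ∈ W → HasOtherPredecessor n v) → ¬ IsTAC n W
  otherPredecessors⇒¬TAC hasPred (((_ , _ , closed) , _) , (v , W≡[v]) , _)
    with hasPred v (Equivalence.from (W≡[v] v) refl)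
  ... | s , s≢v , arc =
    closed s v (proj₁ arc) (s≢v ∘ Equivalence.to (W≡[v] s)) (Equivalence.from (W≡[v] v) refl) arc

GoldbachSum : ℕ → Set
GoldbachSum n = ∃[ p ] ∃[ q ] (Prime p × Prime q × p + q ≡ n)

¬GoldbachSum⇒¬GAC : ∀ {n W} → ¬ GoldbachSum n → ¬ IsGAC n W
¬GoldbachSum⇒¬GAC ¬sum (_ , v₁ , v₂ , (p₁ , _) , (p₂ , _) , v₁+v₂≡n , _) =
  ¬sum (v₁ , v₂ , p₁ , p₂ , v₁+v₂≡n)

module _ (m : ℕ) where

  vertex₂ : Vertex (8 + m) 2
  vertex₂ = prime[2] , s≤s (s≤s z≤n) , s≤s (s≤s z≤n)

  vertex₃ : Vertex (8 + m) 3
  vertex₃ = prime[3] , s≤s (s≤s z≤n) , s≤s (s≤s (s≤s z≤n))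

  hasOtherPredecessor[2∨3] : ∃[ v ] HasOtherPredecessor (8 + m) v
  hasOtherPredecessor[2∨3] with hasOtherPredecessor? {8 + m} 3 | hasOtherPredecessor? {8 + m} 2
  ... | yes pred₃  | _         = 3 , pred₃
  ... | no  _      | yes pred₂ = 2 , pred₂
  ... | no  ¬pred₃ | no ¬pred₂
    with ¬HasOtherPredecessor⇒power {8 + m} vertex₃ ¬pred₃
       | ¬HasOtherPredecessor⇒power {8 + m} vertex₂ ¬pred₂
  ...  | a , 5+m≡3^a | b , 6+m≡2^b =
    contradiction (trans (+-comm (3 ^ a) 1) (trans (cong suc (sym 5+m≡3^a)) 6+m≡2^b))
                  (3^a+1≢2^b a b (subst (6 ≤_) 6+m≡2^b (m≤m+n 6 m)))

  ¬GoldbachSum⇒∃EAC : ¬ GoldbachSum (8 + m) → ∃[ U ] IsEAC (8 + m) U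
  ¬GoldbachSum⇒∃EAC ¬sum =
    let _ , pred             = hasOtherPredecessor[2∨3]
        W , W⊆U , component = ∃autonomousComponent⊆ (withOtherPredecessor-autonomous {8 + m} pred)
    in W , component ,
       otherPredecessors⇒¬TAC (λ v v∈W → ∈-withOtherPredecessor⁻ (W⊆U v v∈W)) ,
       ¬GoldbachSum⇒¬GAC ¬sum

theorem1 : (n : ℕ) → 2 ∣ n → 4 ≤ n →
    ¬ (∃[ p ] ∃[ q ] (Prime p × Prime q × p + q ≡ n)) →
    ∃[ U ] IsEAC n U
theorem1 0 _ () _
theorem1 1 _ (s≤s ()) _
theorem1 2 _ (s≤s (s≤s ())) _
theorem1 3 _ (s≤s (s≤s (s≤s ()))) _
theorem1 4 _ _ ¬sum = contradiction (2 , 2 , prime[2] , prime[2] , refl) ¬sum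
theorem1 5 _ _ ¬sum = contradiction (2 , 3 , prime[2] , prime[3] , refl) ¬sum
theorem1 6 _ _ ¬sum = contradiction (3 , 3 , prime[3] , prime[3] , refl) ¬sum
theorem1 7 _ _ ¬sum = contradiction (2 , 5 , prime[2] , from-yes (prime? 5) , refl) ¬sum
theorem1 (suc (suc (suc (suc (suc (suc (suc (suc m)))))))) _ _ = ¬GoldbachSum⇒∃EAC m
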